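{- Let $A\subseteq[\omega]^{<\omega}$ be a decidable subset of $\omega$ that is omnipresent. (i) For all positive integers $k,r$ and every $\chi\in r^\omega$, the set $B(A,k,r,\chi):=\{s\in A\mid s\text{ is }(\chi,k)\text{ -monochromatic}\}$ is omnipresent. (ii) For all positive integers $k,r$, the set $$C(A,k,r):=\{s\in[\omega]^{<\omega}\mid\forall\chi\in r^\omega\,\exists t\in[\omega]^{<\omega}[s\circ t\in A\wedge s\circ t\text{ is }(\chi,k)\text{ -monochromatic}]\}$$ is a bar in $[\omega]^\omega$, i.e. $\forall\zeta\in[\omega]^\omega\,\exists n[\langle\zeta(0),\dots,\zeta(n-1)\rangle\in C(A,k,r)]$.
   Context: Setting: intuitionistic mathematics (intuitionistic logic), assuming the axioms of countable choice, Brouwer's Fan Theorem (if $\beta$ is a finitary spread-law and $B\subseteq\omega$ is a bar in $\mathcal{F}_\beta$, some finite $B'\subseteq B$ is a bar in $\mathcal{F}_\beta$; in particular this applies to $r^\omega$) and Brouwer's Bar Theorem in the form of Bar Induction (if $B,C\subseteq\omega$, $B$ is a bar in $\omega^\omega$, $B\subseteq C$ and $\forall s[s\in C\leftrightarrow\forall n[s\ast\langle n\rangle\in C]]$, then $\langle\,\rangle\in C$). Finite sequences of natural numbers are coded bijectively by natural numbers. $[\omega]^n$ is the set of (codes of) strictly increasing sequences of length $n$, $[\omega]^{<\omega}=\bigcup_n[\omega]^n$, $[n]^k=\{s\in[\omega]^k\mid\forall i<k[s(i)<n]\}$, $[\omega]^\omega$ the strictly increasing elements of $\omega^\omega$. For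 finite sequences (or infinite sequences) $s$ and finite $t$ with all $t(i)<\mathrm{length}(s)$, $s\circ t$ is (the code of) $\langle s(t(0)),\dots,s(t(\mathrm{length}(t)-1))\rangle$. $A\subseteq[\omega]^{<\omega}$ is omnipresent iff $\forall\zeta\in[\omega]^\omega\,\exists s\in[\omega]^{<\omega}[\zeta\circ s\in A]$. For a positive integer $r$, $r^\omega=\{\chi\in\omega^\omega\mid\forall i[\chi(i)<r]\}$. For $s\in[\omega]^n$ and $\chi\in\omega^\omega$, $s$ is $(\chi,k)$-monochromatic iff $\forall t\in[n]^k\,\forall u\in[n]^k[\chi(s\circ t)=\chi(s\circ u)]$. Decidable subset of $\omega$: one with a characteristic function in $\omega^\omega$. -}

module Defs where

open import Data.Nat using (ℕ; zero; suc; _<_; _≤_)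
open import Data.List using (List; []; _∷_; map; upTo; length; _∷ʳ_)
open import Data.List.Relation.Unary.All using (All)
open import Data.List.Relation.Unary.Any using (Any)
open import Data.List.Membership.Propositional using (_∈_)
open import Data.Product using (Σ; _×_; ∃)
open import Relation.Binary.PropositionalEquality using (_≡_)
open import Relation.Nullary using (Dec)
open import Function.Bundles using (_⇔_)

-- Finite sequences of natural numbers are represented directly as lists
-- (instead of via a bijective coding by natural numbers).
Seq : Set
Seq = List ℕ

Baire : Set
Baire = ℕ → ℕ

init : Baire → ℕ → Seq
init α n = map α (upTo n)

-- s(i), with a default value 0 outside the domain (only used for i < length s)
at : Seq → ℕ → ℕ
at []       _       = 0
at (x ∷ s)  zero    = x
at (x ∷ s)  (suc i) = at s i

-- s ∘ t = ⟨s(t(0)),…,s(t(length t - 1))⟩  (meaningful when all t(i) < length s)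
_⊚_ : Seq → Seq → Seq
s ⊚ t = map (at s) t

data Incr : Seq → Set where
  incr-[] : Incr []
  incr-[x] : ∀ x → Incr (x ∷ [])
  incr-∷ : ∀ {x y s} → x < y → Incr (y ∷ s) → Incr (x ∷ y ∷ s)

InBox : ℕ → ℕ → Seq → Set
InBox n k t = Incr t × length t ≡ k × All (_< n) t

IncrInf : Baire → Set
IncrInf ζ = ∀ i → ζ i < ζ (suc i)

-- χ ∈ r^ω  (colourings of (codes of) finite sequences)
Colouring : ℕ → Set
Colouring r = Σ (Seq → ℕ) λ χ → ∀ s → χ s < r

Monochromatic : (Seq → ℕ) → ℕ → Seq → Set
Monochromatic χ k s =
  Incr s × (∀ t u → InBox (length s) k t → InBox (length s) k u → χ (s ⊚ t) ≡ χ (s ⊚ u))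

Omnipresent : (Seq → Set) → Set
Omnipresent A = ∀ ζ → IncrInf ζ → Σ Seq λ s → Incr s × A (map ζ s)

Bset : (Seq → Set) → ℕ → (Seq → ℕ) → Seq → Set
Bset A k χ s = A s × Monochromatic χ k s

Cset : (Seq → Set) → ℕ → ℕ → Seq → Set
Cset A k r s = Incr s ×
  ((χ : Colouring r) → Σ Seq λ t →
     Incr t × All (_< length s) t × A (s ⊚ t) × Monochromatic (Data.Product.proj₁ χ) k (s ⊚ t))

BarInIncr : (Seq → Set) → Set
BarInIncr C = ∀ ζ → IncrInf ζ → Σ ℕ λ n → C (init ζ n)

-- Axioms of the setting (not provable in Agda's type theory; countable
-- choice is built into Σ-types and need not be assumed).

-- β is a finitary spread-law (s ∈ β iff β(s) = 0)
FinitarySpreadLaw : (Seq → ℕ) → Set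
FinitarySpreadLaw β =
  β [] ≡ 0 ×
  (∀ s → (β s ≡ 0) ⇔ (Σ ℕ λ n → β (s ∷ʳ n) ≡ 0)) ×
  (Σ (Seq → ℕ) λ γ → ∀ s n → β s ≡ 0 → β (s ∷ʳ n) ≡ 0 → n ≤ γ s)

InSpread : (Seq → ℕ) → Baire → Set
InSpread β α = ∀ n → β (init α n) ≡ 0

BarInSpread : (Seq → ℕ) → (Seq → Set) → Set
BarInSpread β B = ∀ α → InSpread β α → Σ ℕ λ n → B (init α n)

FanTheorem : Set₁
FanTheorem = (β : Seq → ℕ) → FinitarySpreadLaw β → (B : Seq → Set) → BarInSpread β B →
  Σ (List Seq) λ B' → All B B' × BarInSpread β (λ s → s ∈ B')

BarInduction : Set₁
BarInduction = (B C : Seq → Set) →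
  (∀ α → Σ ℕ λ n → B (init α n)) →
  (∀ s → B s → C s) →
  (∀ s → C s ⇔ (∀ n → C (s ∷ʳ n))) →
  C []

-- The core is Ramsey's theorem for inductive bars on stacks: if every ≺-increasing
-- growth of a stack eventually contains an A-set, then it eventually contains an A-set that is
-- homogeneous for the k-subsets under a colouring with finitely many colours.  For the step from
-- k to k + 1 the stack is kept end-homogeneous, so that the colour of a (k+1)-subset does not
-- depend on its top element: a new element is classified by the finitely many colours it gives to
-- the k-subsets of the stack, and the classes are grown side by side.  Recording every element
-- together with its successor then turns (k+1)-homogeneity into k-homogeneity of pairs, to which
-- the induction hypothesis applies.
--
-- Bar induction turns the omnipresence of A along ζ into such an inductive bar, which gives (i).
-- For (ii), colourings are coded as points of the fan r^ω; by (i) every point has an initial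
-- segment that decides a monochromatic A-set, and the Fan Theorem provides finitely many such
-- segments, hence a bound n on the sets, so that ζ̄n ∈ C(A,k,r).

module Submission where

open import Defs
open import Data.Empty using (⊥; ⊥-elim)
open import Data.Nat
  using (ℕ; zero; suc; _+_; _∸_; _<_; _>_; _≤_; _≥_; _⊔_; z≤n; s≤s; s≤s⁻¹; _≟_; _<?_)
open import Data.Nat.Properties
  using (≤-refl; ≤-trans; <-trans; <-≤-trans; <⇒≤; ≤∧≢⇒<; m<1+n⇒m<n∨m≡n; suc-injective; 0≢1+n;
         +-suc; +-comm; +-identityʳ; n∸n≡0; m+n∸n≡m; m∸n+n≡m; m≤n+m; n≤1+n; n<1+n;
         +-mono-≤; +-monoʳ-≤; m≤m⊔n; m≤n⊔m)
import Data.List as List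
open import Data.List
  using (List; []; _∷_; [_]; map; length; _++_; reverse; foldl; upTo; downFrom; applyUpTo;
         cartesianProductWith)
open import Data.List.Extrema.Nat using (max; xs≤max)
open import Data.List.Properties
  using (length-map; length-reverse; length-upTo; ++-assoc; ∷-injectiveˡ; ∷-injectiveʳ; ≡-dec;
         map-∘; map-++; map-upTo; map-cong-local; upTo-∷ʳ; unfold-reverse; reverse-involutive;
         reverse-map; foldl-∷ʳ)
open import Data.List.Membership.Propositional using (_∈_)
open import Data.List.Membership.Propositional.Properties
  using (∈-map⁺; ∈-++⁺ˡ; ∈-++⁺ʳ; ∈-cartesianProductWith⁺; ∈-upTo⁺)
open import Data.List.Relation.Unary.All as All using (All; []; _∷_; all?)
import Data.List.Relation.Unary.All.Properties as All
import Data.List.Relation.Unary.Any.Properties as Any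
open import Data.List.Relation.Unary.Any using (here; there)
open import Data.List.Relation.Unary.AllPairs as AllPairs using (AllPairs; []; _∷_)
import Data.List.Relation.Unary.AllPairs.Properties as AllPairs
open import Data.List.Relation.Unary.Linked using (Linked; []; [-]; _∷_)
open import Data.List.Relation.Unary.Linked.Properties using (AllPairs⇒Linked; Linked⇒AllPairs)
open import Data.List.Relation.Binary.Sublist.Propositional
  using (_⊆_; []; _∷_; _∷ʳ_; ⊆-refl; ⊆-trans; ⊆-reflexive)
open import Data.List.Relation.Binary.Sublist.Propositional.Properties
  using (All-resp-⊆; ++⁺; ∷ˡ⁻; []⊆-universal)
import Data.List.Relation.Binary.Sublist.Propositional.Properties as Sublist
open import Data.Product using (Σ; ∃; _×_; _,_; proj₁; proj₂)
open import Data.Sum using (inj₁; inj₂; [_,_]′)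
open import Data.Unit using (⊤; tt)
open import Function using (_∘_; id; flip; _on_)
open import Function.Bundles using (_⇔_; mk⇔; Equivalence)
open import Relation.Nullary using (¬_; Dec; yes; no)
open import Relation.Nullary.Decidable using (toSum)
open import Relation.Unary using (Decidable)
open import Relation.Binary.PropositionalEquality
  using (_≡_; _≢_; refl; sym; trans; cong; subst; subst₂; module ≡-Reasoning)

private
  variable
    X Y : Set

⊆-map-lift : (f : X → Y) (xs : List X) {ys : List Y} → ys ⊆ map f xs →
             ∃ λ zs → zs ⊆ xs × map f zs ≡ ys
⊆-map-lift f []       []          = [] , [] , refl
⊆-map-lift f (x ∷ xs) (_ ∷ʳ σ)    with ⊆-map-lift f xs σ
... | zs , τ , refl = zs , x ∷ʳ τ , refl
⊆-map-lift f (x ∷ xs) (refl ∷ σ)  with ⊆-map-lift f xs σ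
... | zs , τ , refl = x ∷ zs , refl ∷ τ , refl

map-≡-∈ : ∀ {f g : X → Y} {xs x} → map f xs ≡ map g xs → x ∈ xs → f x ≡ g x
map-≡-∈ {xs = _ ∷ _} eq (here refl) = ∷-injectiveˡ eq
map-≡-∈ {xs = _ ∷ _} eq (there x∈) = map-≡-∈ (∷-injectiveʳ eq) x∈

All-reverse : ∀ {P : X → Set} {xs} → All P xs → All P (reverse xs)
All-reverse ps = All.tabulate (All.lookup ps ∘ Any.reverse⁻)

AllPairs-⊆ : ∀ {R : X → X → Set} {xs ys : List X} → xs ⊆ ys → AllPairs R ys → AllPairs R xs
AllPairs-⊆ []         []       = []
AllPairs-⊆ (_ ∷ʳ σ)   (_ ∷ ps) = AllPairs-⊆ σ ps
AllPairs-⊆ (refl ∷ σ) (p ∷ ps) = All-resp-⊆ σ p ∷ AllPairs-⊆ σ ps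

AllPairs-reverse : ∀ {R : X → X → Set} {xs : List X} → AllPairs R xs → AllPairs (flip R) (reverse xs)
AllPairs-reverse {xs = []}     []       = []
AllPairs-reverse {xs = x ∷ xs} (p ∷ ps) = subst (AllPairs _) (sym (unfold-reverse x xs))
  (AllPairs.++⁺ (AllPairs-reverse ps) ([] ∷ []) (All.map (_∷ []) (All-reverse p)))

sublistsOfLength : ℕ → List X → List (List X)
sublistsOfLength zero    xs       = [ [] ]
sublistsOfLength (suc k) []       = []
sublistsOfLength (suc k) (x ∷ xs) =
  map (x ∷_) (sublistsOfLength k xs) ++ sublistsOfLength (suc k) xs

∈-sublistsOfLength : ∀ {xs ys : List X} → ys ⊆ xs → ys ∈ sublistsOfLength (length ys) xs
∈-sublistsOfLength {ys = []}    _          = here refl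
∈-sublistsOfLength {ys = _ ∷ _} (x ∷ʳ σ)   = ∈-++⁺ʳ _ (∈-sublistsOfLength σ)
∈-sublistsOfLength {ys = _ ∷ _} (refl ∷ σ) = ∈-++⁺ˡ (∈-map⁺ _ (∈-sublistsOfLength σ))

listsBelow : ℕ → ℕ → List (List ℕ)
listsBelow zero    r = [ [] ]
listsBelow (suc m) r = cartesianProductWith _∷_ (upTo r) (listsBelow m r)

map-∈-listsBelow : ∀ {r} {f : X → ℕ} → (∀ x → f x < r) → ∀ xs → map f xs ∈ listsBelow (length xs) r
map-∈-listsBelow f<r []       = here refl
map-∈-listsBelow f<r (x ∷ xs) =
  ∈-cartesianProductWith⁺ _∷_ (∈-upTo⁺ (f<r x)) (map-∈-listsBelow f<r xs)

-- Inductive bars on stacks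

HasSublist : (List X → Set) → List X → Set
HasSublist A u = ∃ λ v → v ⊆ u × A v

HasSublist-mono : ∀ {A : List X → Set} {u w} → u ⊆ w → HasSublist A u → HasSublist A w
HasSublist-mono σ (v , τ , a) = v , ⊆-trans τ σ , a

Homogeneous : (List X → ℕ) → ℕ → List X → Set
Homogeneous χ k v = ∀ {t t′} → t ⊆ v → t′ ⊆ v → length t ≡ k → length t′ ≡ k → χ t ≡ χ t′

homogeneous-0 : (χ : List X → ℕ) (v : List X) → Homogeneous χ 0 v
homogeneous-0 χ v {[]} {[]} _ _ _ _ = refl

module _ (_≺_ : X → X → Set) where

  data Barred (G : X → Set) (F : List X → Set) : List X → Set where
    now   : ∀ {u} → F u → Barred G F u
    later : ∀ {u} → (∀ x → All (_≺ x) u → G x → Barred G F (x ∷ u)) → Barred G F u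

  Bar : (List X → Set) → List X → Set
  Bar = Barred (λ _ → ⊤)

module _ {_≺_ : X → X → Set} where

  Barred-map : ∀ {G G′ F F′} → (∀ {x} → G′ x → G x) → (∀ {u} → F u → F′ u) →
               ∀ {u} → Barred _≺_ G F u → Barred _≺_ G′ F′ u
  Barred-map g f (now p)   = now (f p)
  Barred-map g f (later h) = later λ x above gx → Barred-map g f (h x above (g gx))

  Barred-++ : ∀ {G G′ F F′} (w : List X) → (∀ {u} → F u → F′ (u ++ w)) →
              (∀ {u x} → All (_≺ x) (u ++ w) → G′ x → G x) →
              ∀ {u} → Barred _≺_ G F u → Barred _≺_ G′ F′ (u ++ w)
  Barred-++ w f g (now p)       = now (f p)
  Barred-++ w f g {u} (later h) =
    later λ x above gx → Barred-++ w f g (h x (All.++⁻ˡ u above) (g above gx))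

  module _ {F : List X → Set} (F-mono : ∀ {u v} → u ⊆ v → F u → F v) where

    -- Both games are played on the same stack u: each new element is routed to u₁ or u₂ by φ.
    interleave : ∀ {G φ : X → Set} → Decidable φ → ∀ {u u₁ u₂} → u₁ ⊆ u → u₂ ⊆ u →
                 Barred _≺_ (λ x → G x × φ x) F u₁ → Barred _≺_ (λ x → G x × ¬ φ x) F u₂ →
                 Barred _≺_ G F u
    interleave φ? σ₁ σ₂ (now p)    _          = now (F-mono σ₁ p)
    interleave φ? σ₁ σ₂ (later _)  (now p)    = now (F-mono σ₂ p)
    interleave φ? σ₁ σ₂ (later h₁) (later h₂) = later λ x above gx → [
        (λ φx → interleave φ? (refl ∷ σ₁) (x ∷ʳ σ₂) (h₁ x (All-resp-⊆ σ₁ above) (gx , φx)) (later h₂)) ,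
        (λ ¬φx → interleave φ? (x ∷ʳ σ₁) (refl ∷ σ₂) (later h₁) (h₂ x (All-resp-⊆ σ₂ above) (gx , ¬φx)))
      ]′ (toSum (φ? x))

    Barred-⋃ : ∀ {G : X → Set} {K : Set} → (∀ (a b : K) → Dec (a ≡ b)) → (key : X → K) → ∀ κs →
               (∀ {κ} → κ ∈ κs → Barred _≺_ (λ x → G x × key x ≡ κ) F []) →
               Barred _≺_ (λ x → G x × key x ∈ κs) F []
    Barred-⋃ _≟ₖ_ key []       bars = later λ _ _ ()
    Barred-⋃ {G} _≟ₖ_ key (κ ∷ κs) bars =
      interleave (λ x → key x ≟ₖ κ) [] []
        (Barred-map at-κ id (bars (here refl)))
        (Barred-map in-κs id (Barred-⋃ _≟ₖ_ key κs (bars ∘ there)))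
      where
        at-κ : ∀ {x} → (G x × key x ∈ κ ∷ κs) × key x ≡ κ → G x × key x ≡ κ
        at-κ ((g , _) , e) = g , e
        in-κs : ∀ {x} → (G x × key x ∈ κ ∷ κs) × ¬ key x ≡ κ → G x × key x ∈ κs
        in-κs ((g , here e)  , ¬e) = ⊥-elim (¬e e)
        in-κs ((g , there m) , _)  = g , m

Homogeneous-map : (f : X → Y) {χ : List Y → ℕ} {k : ℕ} {v : List X} →
                  Homogeneous (χ ∘ map f) k v → Homogeneous χ k (map f v)
Homogeneous-map f {v = v} hom τ τ′ l l′ with ⊆-map-lift f v τ | ⊆-map-lift f v τ′
... | t , σ , refl | t′ , σ′ , refl =
  hom σ σ′ (trans (sym (length-map f t)) l) (trans (sym (length-map f t′)) l′)

Bar-push : ∀ {_≺_ : X → X → Set} {A : List X → Set} {u x} →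
           Bar _≺_ (HasSublist A) u → All (_≺ x) u → Bar _≺_ (HasSublist A) (x ∷ u)
Bar-push (now found) _     = now (HasSublist-mono (_ ∷ʳ ⊆-refl) found)
Bar-push (later h)   above = h _ above tt

-- Ramsey's theorem for inductive bars

module RamseyStep (k : ℕ) {X : Set} (_≺_ : X → X → Set) {r : ℕ}
                  (A : List X → Set) (χ : List X → ℕ) (χ<r : ∀ v → χ v < r) where

  Pair : Set
  Pair = X × X

  _≺ᴾ_ : Pair → Pair → Set
  _≺ᴾ_ = _≺_ on proj₁

  firsts : List Pair → List X
  firsts = map proj₁

  Aᴾ : List Pair → Set
  Aᴾ = A ∘ firsts

  -- A pair (s , s⁺) is an element s together with the element s⁺ pushed right after it;
  -- χᴾ [] is a junk value.
  χᴾ : List Pair → ℕ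
  χᴾ []              = χ []
  χᴾ ((s , s⁺) ∷ ps) = χ (s⁺ ∷ s ∷ firsts ps)

  χᴾ<r : ∀ ps → χᴾ ps < r
  χᴾ<r []      = χ<r _
  χᴾ<r (_ ∷ _) = χ<r _

  lift-bar : ∀ {u} → Bar _≺_ (HasSublist A) u → ∀ ps → firsts ps ≡ u → Bar _≺ᴾ_ (HasSublist Aᴾ) ps
  lift-bar (now (v , σ , a)) ps refl with ⊆-map-lift proj₁ ps σ
  ... | vᴾ , σᴾ , refl = now (vᴾ , σᴾ , a)
  lift-bar (later h)         ps refl =
    later λ q above _ → lift-bar (h (proj₁ q) (All.map⁺ above) tt) (q ∷ ps) refl

  HomogeneousA : List X → Set
  HomogeneousA v = A v × Homogeneous χ (suc k) v

  HomogeneousAᴾ : List Pair → Set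
  HomogeneousAᴾ vp = Aᴾ vp × Homogeneous χᴾ k vp

  -- Stacks grown on top of a fixed base p.
  Found : List X → List X → Set
  Found p v = HasSublist HomogeneousA (v ++ p)

  Found-mono : ∀ p {u v} → u ⊆ v → Found p u → Found p v
  Found-mono p σ = HasSublist-mono (++⁺ σ ⊆-refl)

  EndCompatible : List X → X → Set
  EndCompatible p x = ∀ {z S} → length S ≡ k → z ∷ S ⊆ p → χ (x ∷ S) ≡ χ (z ∷ S)

  EndHomogeneous : List X → Set
  EndHomogeneous p = ∀ {z z′ S} → length S ≡ k → z ∷ S ⊆ p → z′ ∷ S ⊆ p → χ (z ∷ S) ≡ χ (z′ ∷ S)

  endHomogeneous-[] : EndHomogeneous []
  endHomogeneous-[] _ ()

  endHomogeneous-∷ : ∀ {p x} → EndHomogeneous p → EndCompatible p x → EndHomogeneous (x ∷ p)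
  endHomogeneous-∷ eh ec l (refl ∷ _) (refl ∷ _)  = refl
  endHomogeneous-∷ eh ec l (refl ∷ _) (_ ∷ʳ σ′)   = ec l σ′
  endHomogeneous-∷ eh ec l (_ ∷ʳ σ)   (refl ∷ _)  = sym (ec l σ)
  endHomogeneous-∷ eh ec l (_ ∷ʳ σ)   (_ ∷ʳ σ′)   = eh l σ σ′

  Admissible : List X → X → Set
  Admissible p x = All (_≺ x) p × EndCompatible p x

  key : List X → X → List ℕ
  key p x = map (λ S → χ (x ∷ S)) (sublistsOfLength k p)

  endCompatible-∷ : ∀ {p x₀ x} → EndCompatible p x → key p x ≡ key p x₀ → EndCompatible (x₀ ∷ p) x
  endCompatible-∷ {p} ec eq l (refl ∷ σ) =
    map-≡-∈ eq (subst (λ n → _ ∈ sublistsOfLength n p) l (∈-sublistsOfLength σ))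
  endCompatible-∷ ec eq l (_ ∷ʳ σ)       = ec l σ

  keys : List X → List (List ℕ)
  keys p = listsBelow (length (sublistsOfLength k p)) r

  -- Admissible elements are sorted by their key, of which there are finitely many.  In the
  -- slot of a key the first element x₀ is pushed onto p, and the later ones, having the key
  -- of x₀, are admissible for x₀ ∷ p and play the game at x₀ ∷ p.
  expand : ∀ p → (∀ x₀ → Admissible p x₀ → Barred _≺_ (Admissible (x₀ ∷ p)) (Found (x₀ ∷ p)) []) →
           Barred _≺_ (Admissible p) (Found p) []
  expand p child =
    Barred-map (λ adm → adm , map-∈-listsBelow (λ S → χ<r _) (sublistsOfLength k p)) id
      (Barred-⋃ (Found-mono p) (≡-dec _≟_) (key p) (keys p) slot)
    where
      slot : ∀ {κ} → κ ∈ keys p → Barred _≺_ (λ x → Admissible p x × key p x ≡ κ) (Found p) []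
      slot _ = later λ where
        x₀ _ (adm₀ , key₀) →
          Barred-++ [ x₀ ] (λ {v} → subst (HasSublist HomogeneousA) (sym (++-assoc v [ x₀ ] p)))
            (λ {v} above ((x≻p , ec) , key≡) →
              All.head (All.++⁻ʳ v above) ∷ x≻p , λ {_} {_} → endCompatible-∷ ec (trans key≡ (sym key₀)))
            (child x₀ adm₀)

  successorPairs : List X → List Pair
  successorPairs []           = []
  successorPairs (_ ∷ [])     = []
  successorPairs (s⁺ ∷ s ∷ p) = (s , s⁺) ∷ successorPairs (s ∷ p)

  firsts-successorPairs : ∀ y p → firsts (successorPairs (y ∷ p)) ≡ p
  firsts-successorPairs y []      = refl
  firsts-successorPairs y (s ∷ p) = cong (s ∷_) (firsts-successorPairs s p)

  firsts-successorPairs-⊆ : ∀ p → firsts (successorPairs p) ⊆ p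
  firsts-successorPairs-⊆ []      = []
  firsts-successorPairs-⊆ (y ∷ p) = y ∷ʳ ⊆-reflexive (firsts-successorPairs y p)

  successor-⊆ : ∀ p {s s⁺ ps} → (s , s⁺) ∷ ps ⊆ successorPairs p → s⁺ ∷ s ∷ firsts ps ⊆ p
  successor-⊆ (y ∷ s ∷ p) (_ ∷ʳ σ)   = y ∷ʳ successor-⊆ (s ∷ p) σ
  successor-⊆ (y ∷ s ∷ p) (refl ∷ σ) =
    refl ∷ refl ∷ ⊆-trans (Sublist.map⁺ proj₁ σ) (⊆-reflexive (firsts-successorPairs s p))

  too-long : ∀ {n} → k ≡ 0 → suc (suc n) ≡ suc k → ⊥
  too-long k≡0 l = 0≢1+n (trans (sym k≡0) (sym (suc-injective l)))

  singletons-homogeneous : ∀ {p} → EndHomogeneous p → k ≡ 0 → Homogeneous χ (suc k) p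
  singletons-homogeneous eh k≡0 {_ ∷ []}    {_ ∷ []}    σ σ′ _ _ = eh (sym k≡0) σ σ′
  singletons-homogeneous eh k≡0 {[]}                    _ _  () _
  singletons-homogeneous eh k≡0 {_ ∷ []}    {[]}        _ _  _ ()
  singletons-homogeneous eh k≡0 {_ ∷ _ ∷ _}             _ _  l _ = ⊥-elim (too-long k≡0 l)
  singletons-homogeneous eh k≡0 {_ ∷ []}    {_ ∷ _ ∷ _} _ _  _ l = ⊥-elim (too-long k≡0 l)

  -- The top of a (k+1)-subset of firsts vp may be replaced by the successor of the element
  -- below it, which turns its colour into a χᴾ-colour.
  colour-via-pairs : ∀ {p vp T} → EndHomogeneous p → vp ⊆ successorPairs p → T ⊆ firsts vp →
                     length T ≡ suc k → k ≢ 0 → ∃ λ Sᴾ → Sᴾ ⊆ vp × length Sᴾ ≡ k × χ T ≡ χᴾ Sᴾ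
  colour-via-pairs {vp = vp} eh σ τ l k≢0 with ⊆-map-lift proj₁ vp τ
  ... | []    , _ , refl = ⊥-elim (0≢1+n l)
  ... | _ ∷ [] , _ , refl = ⊥-elim (k≢0 (sym (suc-injective l)))
  ... | (z , _) ∷ (s , s⁺) ∷ Sᴾ , τᴾ , refl =
    (s , s⁺) ∷ Sᴾ , ∷ˡ⁻ τᴾ , trans (cong suc (sym (length-map proj₁ Sᴾ))) (suc-injective l) ,
    eh (suc-injective l) (⊆-trans τ (⊆-trans (Sublist.map⁺ proj₁ σ) (firsts-successorPairs-⊆ _)))
       (successor-⊆ _ (⊆-trans (∷ˡ⁻ τᴾ) σ))

  homogeneous-via-pairs : ∀ {p vp} → EndHomogeneous p → vp ⊆ successorPairs p →
                          Homogeneous χᴾ k vp → Homogeneous χ (suc k) (firsts vp)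
  homogeneous-via-pairs {p} {vp} eh σ hom τ τ′ l l′ with k ≟ 0
  ... | yes k≡0 = singletons-homogeneous eh k≡0 (⊆-trans τ p⊆) (⊆-trans τ′ p⊆) l l′
    where
      p⊆ : firsts vp ⊆ p
      p⊆ = ⊆-trans (Sublist.map⁺ proj₁ σ) (firsts-successorPairs-⊆ p)
  ... | no k≢0 with colour-via-pairs eh σ τ l k≢0 | colour-via-pairs eh σ τ′ l′ k≢0
  ...   | _ , σᴾ , lᴾ , eq | _ , σᴾ′ , lᴾ′ , eq′ = trans eq (trans (hom σᴾ σᴾ′ lᴾ lᴾ′) (sym eq′))

  found-via-pairs : ∀ {p} → EndHomogeneous p → HasSublist HomogeneousAᴾ (successorPairs p) →
                    HasSublist HomogeneousA p
  found-via-pairs {p} eh (vp , σ , a , hom) =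
    firsts vp , ⊆-trans (Sublist.map⁺ proj₁ σ) (firsts-successorPairs-⊆ p) , a ,
    homogeneous-via-pairs eh σ hom

  grow : ∀ y p → AllPairs (flip _≺_) (y ∷ p) → EndHomogeneous (y ∷ p) →
         Bar _≺ᴾ_ (HasSublist HomogeneousAᴾ) (successorPairs (y ∷ p)) →
         Barred _≺_ (Admissible (y ∷ p)) (Found (y ∷ p)) []
  grow y p chain eh (now found) = now (found-via-pairs eh found)
  grow y p chain@(y≻p ∷ _) eh (later h) =
    expand (y ∷ p) λ x (x≻ , ec) →
      grow x (y ∷ p) (x≻ ∷ chain) (endHomogeneous-∷ eh ec) (h (y , x) (pairs≺ {x}) tt)
    where
      pairs≺ : ∀ {x} → All (_≺ᴾ (y , x)) (successorPairs (y ∷ p))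
      pairs≺ = All.map⁻ (subst (All (_≺ y)) (sym (firsts-successorPairs y p)) y≻p)

  step : Bar _≺ᴾ_ (HasSublist HomogeneousAᴾ) [] → Bar _≺_ (HasSublist HomogeneousA) []
  step bar = Barred-++ [] id (λ _ _ → [] , λ { _ () })
    (expand [] λ x (_ , ec) → grow x [] ([] ∷ []) (endHomogeneous-∷ endHomogeneous-[] ec) bar)

ramsey : ∀ k {X} (_≺_ : X → X → Set) {r} (A : List X → Set) (χ : List X → ℕ) → (∀ v → χ v < r) →
         Bar _≺_ (HasSublist A) [] → Bar _≺_ (HasSublist (λ v → A v × Homogeneous χ k v)) []
ramsey zero    _≺_ A χ χ<r bar =
  Barred-map id (λ (v , σ , a) → v , σ , a , homogeneous-0 χ v) bar
ramsey (suc k) _≺_ A χ χ<r bar = step (ramsey k _≺ᴾ_ Aᴾ χᴾ χᴾ<r (lift-bar bar [] refl))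
  where open RamseyStep k _≺_ A χ χ<r

-- Increasing sequences and part (i)

below-suc-max : ∀ xs → All (_< suc (max 0 xs)) xs
below-suc-max xs = All.map s≤s (xs≤max 0 xs)

Incr⇒AllPairs : ∀ {s} → Incr s → AllPairs _<_ s
Incr⇒AllPairs = Linked⇒AllPairs <-trans ∘ linked
  where
    linked : ∀ {s} → Incr s → Linked _<_ s
    linked incr-[]        = []
    linked (incr-[x] x)   = [-]
    linked (incr-∷ x<y i) = x<y ∷ linked i

AllPairs⇒Incr : ∀ {s} → AllPairs _<_ s → Incr s
AllPairs⇒Incr = incr ∘ AllPairs⇒Linked
  where
    incr : ∀ {s} → Linked _<_ s → Incr s
    incr []        = incr-[]
    incr [-]       = incr-[x] _
    incr (x<y ∷ l) = incr-∷ x<y (incr l)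

downFrom-descending : ∀ n → AllPairs _>_ (downFrom n)
downFrom-descending n = AllPairs.applyDownFrom⁺₁ id n (λ j<i _ → j<i)

descending⊆downFrom : ∀ {n v} → AllPairs _>_ v → All (_< n) v → v ⊆ downFrom n
descending⊆downFrom {zero}  {[]}    _          _          = []
descending⊆downFrom {zero}  {_ ∷ _} _          (() ∷ _)
descending⊆downFrom {suc n} {[]}    _          _          = []⊆-universal _
descending⊆downFrom {suc n} {x ∷ v} (v<x ∷ d) (x<1+n ∷ _) with x ≟ n
... | yes refl = refl ∷ descending⊆downFrom d v<x
... | no  x≢n  = n ∷ʳ descending⊆downFrom (v<x ∷ d) (x<n ∷ All.map (λ y<x → <-trans y<x x<n) v<x)
  where
    x<n : x < n
    x<n = ≤∧≢⇒< (s≤s⁻¹ x<1+n) x≢n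

reverse-downFrom : ∀ n → reverse (downFrom n) ≡ upTo n
reverse-downFrom zero    = refl
reverse-downFrom (suc n) =
  trans (unfold-reverse n (downFrom n)) (trans (cong (List._∷ʳ n) (reverse-downFrom n)) (upTo-∷ʳ n))

ascending⊆upTo : ∀ {n t} → AllPairs _<_ t → All (_< n) t → t ⊆ upTo n
ascending⊆upTo {n} {t} asc t<n =
  subst₂ _⊆_ (reverse-involutive t) (reverse-downFrom n)
    (Sublist.reverse⁺ (descending⊆downFrom (AllPairs-reverse asc) (All-reverse t<n)))

at-applyUpTo : ∀ (f : ℕ → ℕ) {n i} → i < n → at (applyUpTo f n) i ≡ f i
at-applyUpTo f {suc n} {zero}  _         = refl
at-applyUpTo f {suc n} {suc i} (s≤s i<n) = at-applyUpTo (f ∘ suc) i<n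

applyUpTo-at : ∀ s → applyUpTo (at s) (length s) ≡ s
applyUpTo-at []      = refl
applyUpTo-at (x ∷ s) = cong (x ∷_) (applyUpTo-at s)

⊚-⊆ : ∀ s {t} → AllPairs _<_ t → All (_< length s) t → s ⊚ t ⊆ s
⊚-⊆ s asc t<n = subst (s ⊚ _ ⊆_) (trans (map-upTo (at s) (length s)) (applyUpTo-at s))
  (Sublist.map⁺ (at s) (ascending⊆upTo asc t<n))

length-init : ∀ α n → length (init α n) ≡ n
length-init α n = trans (length-map α (upTo n)) (length-upTo n)

at-init : ∀ α {n i} → i < n → at (init α n) i ≡ α i
at-init α {n} i<n = trans (cong (λ s → at s _) (map-upTo α n)) (at-applyUpTo α i<n)

IncrInf-mono : ∀ {ζ} → IncrInf ζ → ∀ {i j} → i < j → ζ i < ζ j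
IncrInf-mono ζ↑ {i} {suc j} i<1+j with m<1+n⇒m<n∨m≡n i<1+j
... | inj₁ i<j  = <-trans (IncrInf-mono ζ↑ i<j) (ζ↑ j)
... | inj₂ refl = ζ↑ i

Incr-map : ∀ {ζ} → IncrInf ζ → ∀ {s} → Incr s → Incr (map ζ s)
Incr-map ζ↑ = AllPairs⇒Incr ∘ AllPairs.map⁺ ∘ AllPairs.map (IncrInf-mono ζ↑) ∘ Incr⇒AllPairs

Incr-init : ∀ {ζ} → IncrInf ζ → ∀ n → Incr (init ζ n)
Incr-init ζ↑ n =
  AllPairs⇒Incr (AllPairs.map⁺ (AllPairs.applyUpTo⁺₁ id n (λ i<j _ → IncrInf-mono ζ↑ i<j)))

monochromatic-of-homogeneous : ∀ {χ k s} → Incr s → Homogeneous (χ ∘ reverse) k (reverse s) →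
                               Monochromatic χ k s
monochromatic-of-homogeneous {χ} {k} {s} incr hom = incr , λ t u bt bu →
  subst₂ (λ a b → χ a ≡ χ b) (reverse-involutive (s ⊚ t)) (reverse-involutive (s ⊚ u))
    (hom (reversed-⊆ bt) (reversed-⊆ bu) (reversed-length bt) (reversed-length bu))
  where
    reversed-⊆ : ∀ {t} → InBox (length s) k t → reverse (s ⊚ t) ⊆ reverse s
    reversed-⊆ (it , _ , t<n) = Sublist.reverse⁺ (⊚-⊆ s (Incr⇒AllPairs it) t<n)
    reversed-length : ∀ {t} → InBox (length s) k t → length (reverse (s ⊚ t)) ≡ k
    reversed-length {t} (_ , lt , _) = trans (length-reverse (s ⊚ t)) (trans (length-map (at s) t) lt)

omnipresent-∘ : ∀ {A ζ} → Omnipresent A → IncrInf ζ → Omnipresent (A ∘ map ζ)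
omnipresent-∘ {A} {ζ} omni ζ↑ η η↑ with omni (ζ ∘ η) (λ i → IncrInf-mono ζ↑ (η↑ i))
... | s , incr , a = s , incr , subst A (map-∘ s) a

-- push u n puts a new element n + 1 places above the top of u (at n on the empty stack), and
-- every element above the top of a descending stack arises in this way.
push : List ℕ → ℕ → List ℕ
push []      n = [ n ]
push (y ∷ u) n = suc (n + y) ∷ y ∷ u

stack : Seq → List ℕ
stack = foldl push []

push-above : ∀ {u} → AllPairs _>_ u → ∀ n → ∃ λ x → push u n ≡ x ∷ u × All (_< x) u
push-above {[]}    _         n = n , refl , []
push-above {y ∷ u} (u<y ∷ _) n = suc (n + y) , refl , y<x ∷ All.map (λ z<y → <-trans z<y y<x) u<y
  where
    y<x : y < suc (n + y)
    y<x = s≤s (m≤n+m y n)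

push-onto : ∀ {u x} → All (_< x) u → ∃ λ n → push u n ≡ x ∷ u
push-onto {[]}    {x} _         = x , refl
push-onto {y ∷ u} {x} (y<x ∷ _) =
  x ∸ suc y , cong (_∷ y ∷ u) (trans (sym (+-suc (x ∸ suc y) y)) (m∸n+n≡m y<x))

stack-∷ʳ : ∀ s n → stack (s List.∷ʳ n) ≡ push (stack s) n
stack-∷ʳ s n = foldl-∷ʳ push [] n s

stack-descending : ∀ s → AllPairs _>_ (stack s)
stack-descending = go []
  where
    go : ∀ {u} → AllPairs _>_ u → ∀ s → AllPairs _>_ (foldl push u s)
    go d []      = d
    go d (n ∷ s) with push-above d n
    ... | x , eq , u<x = go (subst (AllPairs _>_) (sym eq) (u<x ∷ d)) s

accumulate : Baire → Baire
accumulate α zero    = α zero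
accumulate α (suc i) = suc (α (suc i) + accumulate α i)

accumulate-increasing : ∀ α → IncrInf (accumulate α)
accumulate-increasing α i = s≤s (m≤n+m (accumulate α i) (α (suc i)))

init-suc : ∀ α n → init α (suc n) ≡ init α n List.∷ʳ α n
init-suc α n = trans (cong (map α) (sym (upTo-∷ʳ n))) (map-++ α (upTo n) [ n ])

stack-init : ∀ α n → stack (init α n) ≡ map (accumulate α) (downFrom n)
stack-init α zero    = refl
stack-init α (suc n) = begin
  stack (init α (suc n))                        ≡⟨ cong stack (init-suc α n) ⟩
  stack (init α n List.∷ʳ α n)                  ≡⟨ stack-∷ʳ (init α n) (α n) ⟩
  push (stack (init α n)) (α n)                 ≡⟨ cong (λ u → push u (α n)) (stack-init α n) ⟩
  push (map (accumulate α) (downFrom n)) (α n)  ≡⟨ push-accumulate n ⟩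
  map (accumulate α) (downFrom (suc n))         ∎
  where
    open ≡-Reasoning
    push-accumulate : ∀ n → push (map (accumulate α) (downFrom n)) (α n) ≡
                            map (accumulate α) (downFrom (suc n))
    push-accumulate zero    = refl
    push-accumulate (suc n) = refl

-- Omnipresence makes the stacks of the finite sequences of gaps barred along every α, and bar
-- induction turns this into an inductive bar.
omnipresent⇒bar : BarInduction → ∀ {A} → Omnipresent A → Bar _<_ (HasSublist (A ∘ reverse)) []
omnipresent⇒bar bar-induction {A} omni = bar-induction (F ∘ stack) C barred (λ _ → now) hereditary
  where
    F : List ℕ → Set
    F = HasSublist (A ∘ reverse)

    C : Seq → Set
    C = Bar _<_ F ∘ stack

    barred : ∀ α → ∃ λ n → F (stack (init α n))
    barred α with omni (accumulate α) (accumulate-increasing α)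
    ... | s , incr , a = n , subst F (sym (stack-init α n))
      (reverse (map ζ s) , subst (_⊆ map ζ (downFrom n)) (reverse-map ζ s) (Sublist.map⁺ ζ s⊆) ,
       subst A (sym (reverse-involutive (map ζ s))) a)
      where
        ζ : Baire
        ζ = accumulate α
        n : ℕ
        n = suc (max 0 s)
        s⊆ : reverse s ⊆ downFrom n
        s⊆ = descending⊆downFrom (AllPairs-reverse (Incr⇒AllPairs incr)) (All-reverse (below-suc-max s))

    hereditary : ∀ s → C s ⇔ (∀ n → C (s List.∷ʳ n))
    hereditary s = mk⇔ extend retract
      where
        extend : C s → ∀ n → C (s List.∷ʳ n)
        extend bar n with push-above (stack-descending s) n
        ... | x , eq , u<x = subst (Bar _<_ F) (sym (trans (stack-∷ʳ s n) eq)) (Bar-push bar u<x)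
        retract : (∀ n → C (s List.∷ʳ n)) → C s
        retract bars = later λ x u<x _ → let n , eq = push-onto u<x in
          subst (Bar _<_ F) (trans (stack-∷ʳ s n) eq) (bars n)

bar-downFrom : ∀ {F m} → Bar _<_ F (downFrom m) → ∃ λ n → F (downFrom n)
bar-downFrom {m = m} (now found) = m , found
bar-downFrom {m = m} (later h)   = bar-downFrom (h m (All.applyDownFrom⁺₁ id m (λ i<m → i<m)) tt)

omnipresent-monochromatic : BarInduction → ∀ {A} → Omnipresent A → ∀ k {r} (χ : Colouring r) →
                            Omnipresent (Bset A k (proj₁ χ))
omnipresent-monochromatic bar-induction {A} omni k (χ , χ<r) ζ ζ↑
  with bar-downFrom (ramsey k _<_ (A ∘ map ζ ∘ reverse) (χ ∘ reverse ∘ map ζ) (λ _ → χ<r _)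
                       (omnipresent⇒bar bar-induction {A ∘ map ζ} (omnipresent-∘ {A} omni ζ↑)))
... | n , v , σ , a , hom = reverse v , incr , a , monochromatic-of-homogeneous {χ} (Incr-map ζ↑ incr)
  (subst (Homogeneous (χ ∘ reverse) k) ζv≡ (Homogeneous-map ζ hom))
  where
    incr : Incr (reverse v)
    incr = AllPairs⇒Incr (AllPairs-reverse (AllPairs-⊆ σ (downFrom-descending n)))
    ζv≡ : map ζ v ≡ reverse (map ζ (reverse v))
    ζv≡ = trans (cong (map ζ) (sym (reverse-involutive v))) (reverse-map ζ (reverse v))

-- Coding finite sequences

triangle : ℕ → ℕ
triangle zero    = zero
triangle (suc n) = suc n + triangle n

pair : ℕ → ℕ → ℕ
pair a b = triangle (a + b) + b

-- Enumerates ℕ × ℕ along the anti-diagonals, in the order in which pair numbers them.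
next : ℕ × ℕ → ℕ × ℕ
next (suc a , b) = a , suc b
next (zero  , b) = suc b , zero

unpair : ℕ → ℕ × ℕ
unpair zero    = zero , zero
unpair (suc n) = next (unpair n)

unpair-diagonal : ∀ s b → b ≤ s → unpair (triangle s + b) ≡ (s ∸ b , b)
unpair-diagonal zero    zero    _ = refl
unpair-diagonal (suc s) zero    _ =
  trans (cong unpair (trans (+-identityʳ (suc s + triangle s)) (cong suc (+-comm s (triangle s)))))
    (cong next (trans (unpair-diagonal s s ≤-refl) (cong (_, s) (n∸n≡0 s))))
unpair-diagonal s       (suc b) b<s =
  trans (cong unpair (+-suc (triangle s) b))
    (trans (cong next (unpair-diagonal s b (<⇒≤ b<s))) (cong (λ a → next (a , b)) (∸-suc b<s)))
  where
    ∸-suc : ∀ {s b} → b < s → s ∸ b ≡ suc (s ∸ suc b)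
    ∸-suc {suc s} {zero}  _         = refl
    ∸-suc {suc s} {suc b} (s≤s b<s) = ∸-suc b<s

unpair-pair : ∀ a b → unpair (pair a b) ≡ (a , b)
unpair-pair a b = trans (unpair-diagonal (a + b) b (m≤n+m b a)) (cong (_, b) (m+n∸n≡m a b))

code : Seq → ℕ
code []      = 0
code (x ∷ v) = suc (pair x (code v))

-- The fuel bounds the number of entries, which is at most the code.
decodeWithin : ℕ → ℕ → Seq
decodeWithin zero       _       = []
decodeWithin (suc fuel) zero    = []
decodeWithin (suc fuel) (suc n) = proj₁ (unpair n) ∷ decodeWithin fuel (proj₂ (unpair n))

decode : ℕ → Seq
decode n = decodeWithin (suc n) n

decodeWithin-code : ∀ v {fuel} → code v < fuel → decodeWithin fuel (code v) ≡ v
decodeWithin-code []      {suc fuel} _ = refl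
decodeWithin-code (x ∷ v) {suc fuel} (s≤s code<fuel) rewrite unpair-pair x (code v) =
  cong (x ∷_) (decodeWithin-code v (<-≤-trans (s≤s (m≤n+m (code v) (triangle (x + code v)))) code<fuel))

decode-code : ∀ v → decode (code v) ≡ v
decode-code v = decodeWithin-code v ≤-refl

triangle-mono : ∀ {m n} → m ≤ n → triangle m ≤ triangle n
triangle-mono z≤n       = z≤n
triangle-mono (s≤s m≤n) = s≤s (+-mono-≤ m≤n (triangle-mono m≤n))

code-mono : ∀ {v w} → v ⊆ w → code v ≤ code w
code-mono []                   = z≤n
code-mono {w = y ∷ w} (_ ∷ʳ σ) =
  ≤-trans (code-mono σ) (≤-trans (m≤n+m (code w) (triangle (y + code w))) (n≤1+n _))
code-mono {x ∷ _} (refl ∷ σ)   =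
  s≤s (+-mono-≤ (triangle-mono (+-monoʳ-≤ x (code-mono σ))) (code-mono σ))

-- The fan r^ω and part (ii)

boundedLaw : ℕ → Seq → ℕ
boundedLaw r w with all? (_<? r) w
... | yes _ = 0
... | no  _ = 1

boundedLaw≡0⇔ : ∀ r w → boundedLaw r w ≡ 0 ⇔ All (_< r) w
boundedLaw≡0⇔ r w with all? (_<? r) w
... | yes w<r = mk⇔ (λ _ → w<r) (λ _ → refl)
... | no  w≮r = mk⇔ (λ ()) (⊥-elim ∘ w≮r)

module _ {r : ℕ} where
  open module Law {w} = Equivalence (boundedLaw≡0⇔ r w) using ()
    renaming (to to boundedLaw⇒All; from to All⇒boundedLaw)

  boundedLaw-finitary : r ≥ 1 → FinitarySpreadLaw (boundedLaw r)
  boundedLaw-finitary r≥1 =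
    All⇒boundedLaw [] ,
    (λ s → mk⇔ (λ s∈ → 0 , All⇒boundedLaw (All.∷ʳ⁺ (boundedLaw⇒All s∈) r≥1))
               (λ (n , sn∈) → All⇒boundedLaw (proj₁ (All.∷ʳ⁻ (boundedLaw⇒All sn∈))))) ,
    (λ _ → r) , λ s n _ sn∈ → <⇒≤ (proj₂ (All.∷ʳ⁻ (boundedLaw⇒All sn∈)))

  inSpread⇒bounded : ∀ {α} → InSpread (boundedLaw r) α → ∀ i → α i < r
  inSpread⇒bounded {α} α∈ i = All.lookup (boundedLaw⇒All (α∈ (suc i))) (∈-map⁺ α (∈-upTo⁺ (n<1+n i)))

  bounded⇒inSpread : ∀ {α} → (∀ i → α i < r) → InSpread (boundedLaw r) α
  bounded⇒inSpread α<r n = All⇒boundedLaw (All.map⁺ (All.universal α<r (upTo n)))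

common-bound : ∀ {X : Set} {P : X → ℕ → Set} → (∀ {x m n} → m ≤ n → P x m → P x n) →
               ∀ {xs} → All (λ x → ∃ (P x)) xs → ∃ λ n → All (λ x → P x n) xs
common-bound mono []              = 0 , []
common-bound mono ((m , p) ∷ ps) with common-bound mono ps
... | n , qs = m ⊔ n , mono (m≤m⊔n m n) p ∷ All.map (mono (m≤n⊔m m n)) qs

Monochromatic-cong : ∀ {χ χ′ k s} → (∀ {t} → InBox (length s) k t → χ′ (s ⊚ t) ≡ χ (s ⊚ t)) →
                     Monochromatic χ k s → Monochromatic χ′ k s
Monochromatic-cong eq (incr , mono) =
  incr , λ t u bt bu → trans (eq bt) (trans (mono t u bt bu) (sym (eq bu)))

module FanArgument (fan : FanTheorem) (bar-induction : BarInduction) {A : Seq → Set}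
                   (omni : Omnipresent A) (k r : ℕ) (r≥1 : r ≥ 1) {ζ : Baire} (ζ↑ : IncrInf ζ) where

  -- A finite sequence w is read as an initial segment of a colouring, through the coding of Seq.
  Agrees : (Seq → ℕ) → Seq → Set
  Agrees χ w = ∀ v → code v < length w → χ v ≡ at w (code v)

  Decides : ℕ → Seq → Set
  Decides n w = Σ Seq λ s → Incr s × All (_< n) s × A (map ζ s) ×
    ((χ : Colouring r) → Agrees (proj₁ χ) w → Monochromatic (proj₁ χ) k (map ζ s))

  Decides-mono : ∀ {w m n} → m ≤ n → Decides m w → Decides n w
  Decides-mono m≤n (s , incr , s<m , rest) =
    s , incr , All.map (λ i<m → <-≤-trans i<m m≤n) s<m , rest

  -- Only codes below that of u enter the monochromatic property of u, by monotonicity of the coding.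
  monochromatic-of-agrees : ∀ {α u} → Monochromatic (α ∘ code) k u → (χ : Colouring r) →
                            Agrees (proj₁ χ) (init α (suc (code u))) → Monochromatic (proj₁ χ) k u
  monochromatic-of-agrees {α} {u} mono (χ , _) agrees = Monochromatic-cong {α ∘ code} {χ} agree mono
    where
      agree : ∀ {t} → InBox (length u) k t → χ (u ⊚ t) ≡ α (code (u ⊚ t))
      agree {t} (it , _ , t<n) =
        trans (agrees (u ⊚ t) (subst (code (u ⊚ t) <_) (sym (length-init α _)) code<)) (at-init α code<)
        where
          code< : code (u ⊚ t) < suc (code u)
          code< = s≤s (code-mono (⊚-⊆ u (Incr⇒AllPairs it) t<n))

  decided : BarInSpread (boundedLaw r) (λ w → ∃ λ n → Decides n w)
  decided α α∈ =
    let s , incr , a , mono =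
          omnipresent-monochromatic bar-induction {A} omni k (α ∘ code , inSpread⇒bounded α∈ ∘ code) ζ ζ↑
    in suc (code (map ζ s)) , suc (max 0 s) , s , incr , below-suc-max s , a ,
       monochromatic-of-agrees mono

  meets : Σ ℕ λ n → Cset A k r (init ζ n)
  meets with fan (boundedLaw r) (boundedLaw-finitary r≥1) _ decided
  ... | B′ , B′-decided , B′-bar
    with common-bound {P = λ w n → Decides n w} (λ {w} → Decides-mono {w}) B′-decided
  ... | n , decides = n , Incr-init ζ↑ n , witness
    where
      witness : (χ : Colouring r) → Σ Seq λ t → Incr t × All (_< length (init ζ n)) t ×
                  A (init ζ n ⊚ t) × Monochromatic (proj₁ χ) k (init ζ n ⊚ t)
      witness (χ , χ<r) with B′-bar (χ ∘ decode) (bounded⇒inSpread (χ<r ∘ decode))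
      ... | m , w∈B′ with All.lookup decides w∈B′
      ... | s , incr , s<n , a , mono =
        s , incr , subst (λ l → All (_< l) s) (sym (length-init ζ n)) s<n ,
        subst A (sym ⊚≡) a , subst (Monochromatic χ k) (sym ⊚≡) (mono (χ , χ<r) agrees)
        where
          ⊚≡ : init ζ n ⊚ s ≡ map ζ s
          ⊚≡ = map-cong-local (All.map (at-init ζ) s<n)
          agrees : Agrees χ (init (χ ∘ decode) m)
          agrees v code< = sym (trans (at-init (χ ∘ decode) (subst (code v <_) (length-init _ m) code<))
                                      (cong χ (decode-code v)))

Cset-bar : FanTheorem → BarInduction → ∀ {A} → Omnipresent A → ∀ k r → r ≥ 1 → BarInIncr (Cset A k r)
Cset-bar fan bar-induction {A} omni k r r≥1 ζ ζ↑ =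
  FanArgument.meets fan bar-induction {A} omni k r r≥1 ζ↑

theorem7p18 : FanTheorem → BarInduction →
    (A : Seq → Set) → (∀ s → Dec (A s)) → (∀ s → A s → Incr s) → Omnipresent A →
    ((k r : ℕ) → k ≥ 1 → r ≥ 1 → (χ : Colouring r) → Omnipresent (Bset A k (proj₁ χ)))
    × ((k r : ℕ) → k ≥ 1 → r ≥ 1 → BarInIncr (Cset A k r))
theorem7p18 fan bar-induction A _ _ omni =
  (λ k r _ _ → omnipresent-monochromatic bar-induction {A} omni k) ,
  (λ k r _ → Cset-bar fan bar-induction {A} omni k r)
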